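{- The following statements are equivalent: (1) there are infinitely many pairs of primes of the form $\{p,p+2\}$; (2) in $\overrightarrow{\mathcal{G}}_{\infty}$, $d_\infty(2)=d^+_\infty(2)$ and this quantity is infinite.
   Context: Let $\mathcal{P}$ be the set of odd primes and $\mathcal{E}$ the set of non-negative even integers. $\overrightarrow{\mathcal{G}}_{\infty}$ is the directed graph with vertex set $\mathcal{E}$ and an arc $a\to b$ iff $\frac{a+b}{2}\in\mathcal{P}$ and $\frac{b-a}{2}\in\mathcal{P}$. $d^+_\infty(v)$ is the number of out-neighbours of $v$, and $d_\infty(v)$ is the total number of neighbours of $v$ (in-neighbours plus out-neighbours), i.e. the degree of $v$ in the underlying undirected graph. -}

module Defs where

open import Data.Nat using (ℕ; _+_; _*_; _≤_)
open import Data.Nat.Primality using (Prime)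
open import Data.Nat.Divisibility using (_∣_)
open import Data.Product using (Σ; _×_; ∃)
open import Data.Sum using (_⊎_)
open import Data.List using (List; length)
open import Data.List.Membership.Propositional using (_∈_)
open import Data.List.Relation.Unary.Unique.Propositional using (Unique)
open import Relation.Binary.PropositionalEquality using (_≡_)
open import Relation.Nullary using (¬_)
open import Function.Bundles using (_⇔_)

OddPrime : ℕ → Set
OddPrime p = Prime p × ¬ (2 ∣ p)

Even : ℕ → Set
Even a = 2 ∣ a

-- arc a → b in G∞ : a, b ∈ ℰ, (a+b)/2 ∈ 𝒫 and (b-a)/2 ∈ 𝒫
-- (written without division: a + b = 2p and b = a + 2q)
Arc : ℕ → ℕ → Set
Arc a b = Even a × Even b ×
  Σ ℕ (λ p → Σ ℕ (λ q → OddPrime p × OddPrime q × a + b ≡ 2 * p × b ≡ a + 2 * q))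

OutNbr : ℕ → ℕ → Set
OutNbr v w = Arc v w

Nbr : ℕ → ℕ → Set
Nbr v w = Arc w v ⊎ Arc v w

data ℕ∞ : Set where
  fin : ℕ → ℕ∞
  ∞   : ℕ∞

HasCard : (ℕ → Set) → ℕ∞ → Set
HasCard P (fin k) = Σ (List ℕ) (λ xs → length xs ≡ k × Unique xs × (∀ w → P w ⇔ (w ∈ xs)))
HasCard P ∞ = ∀ N → ∃ (λ w → N ≤ w × P w)

OutDeg : ℕ → ℕ∞ → Set
OutDeg v n = HasCard (OutNbr v) n

Deg : ℕ → ℕ∞ → Set
Deg v n = HasCard (Nbr v) n

InfinitelyManyTwinPrimes : Set
InfinitelyManyTwinPrimes = ∀ N → ∃ (λ p → N ≤ p × Prime p × Prime (p + 2))

-- Proof idea: an arc 2 → b forces b = 2 + 2q with q and (2 + b)/2 = q + 2 odd primes,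
-- so the out-neighbours of 2 correspond exactly to the lower members q of twin prime
-- pairs, via q ↦ 2 + 2q. Every out-neighbour is a neighbour, hence infinitely many
-- twin primes give d∞(2) = d⁺∞(2) = ∞, and conversely.
module Submission where

open import Defs
open import Data.Nat using (ℕ; _+_; _*_)
open import Data.Nat.Divisibility using (_∣_; divides; ∣-refl; ∣m∣n⇒∣m+n; ∣m+n∣m⇒∣n; m∣m*n)
open import Data.Nat.Primality using (Prime; prime⇒irreducible)
open import Data.Nat.Properties
  using (+-comm; *-cancelˡ-≡; *-cancelˡ-≤; +-cancelˡ-≤; ≤-trans; m≤n*m; m≤n+m)
open import Data.Nat.Tactic.RingSolver using (solve-∀)
open import Data.Product using (Σ; ∃; _×_; _,_)
open import Data.Sum using (inj₁; inj₂)
open import Function.Bundles using (_⇔_; mk⇔)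
open import Relation.Binary.PropositionalEquality using (_≡_; refl; sym; trans; subst)
open import Relation.Nullary using (¬_)

¬Prime[4] : ¬ Prime 4
¬Prime[4] p with prime⇒irreducible p (divides {m = 2} 2 refl)
... | inj₁ ()
... | inj₂ ()

twin-lower-odd : ∀ {r} → Prime r → Prime (r + 2) → ¬ 2 ∣ r
twin-lower-odd pr pr+2 2∣r with prime⇒irreducible pr 2∣r
... | inj₁ ()
... | inj₂ refl = ¬Prime[4] pr+2

twin-upper-odd : ∀ {r} → Prime r → Prime (r + 2) → ¬ 2 ∣ r + 2
twin-upper-odd {r} pr pr+2 2∣r+2 =
  twin-lower-odd pr pr+2 (∣m+n∣m⇒∣n (subst (2 ∣_) (+-comm r 2) 2∣r+2) ∣-refl)

double-sum : ∀ a q → a + (a + 2 * q) ≡ 2 * (a + q)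
double-sum = solve-∀

Arc⇒OddPrimes : ∀ {a b} → Arc a b → ∃ λ q → b ≡ a + 2 * q × OddPrime q × OddPrime (a + q)
Arc⇒OddPrimes {a} (_ , _ , p , q , oddP , oddQ , a+b≡2p , refl) =
  q , refl , oddQ , subst OddPrime p≡a+q oddP
  where
  p≡a+q : p ≡ a + q
  p≡a+q = *-cancelˡ-≡ p (a + q) 2 (trans (sym a+b≡2p) (double-sum a q))

OddPrimes⇒Arc : ∀ {a q} → Even a → OddPrime q → OddPrime (a + q) → Arc a (a + 2 * q)
OddPrimes⇒Arc {a} {q} even-a oddQ oddA+Q =
  even-a , ∣m∣n⇒∣m+n even-a (m∣m*n q) , a + q , q , oddA+Q , oddQ , double-sum a q , refl

twin⇒Arc-from-2 : ∀ {q} → Prime q → Prime (q + 2) → Arc 2 (2 + 2 * q)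
twin⇒Arc-from-2 {q} pq pq+2 = OddPrimes⇒Arc ∣-refl
  (pq , twin-lower-odd pq pq+2)
  (subst OddPrime (+-comm q 2) (pq+2 , twin-upper-odd pq pq+2))

Arc-from-2⇒twin : ∀ {b} → Arc 2 b → ∃ λ q → b ≡ 2 + 2 * q × Prime q × Prime (q + 2)
Arc-from-2⇒twin arc with Arc⇒OddPrimes arc
... | q , b≡2+2q , (pq , _) , (p2+q , _) = q , b≡2+2q , pq , subst Prime (+-comm 2 q) p2+q

HasCard-∞-mono : ∀ {P Q : ℕ → Set} → (∀ {w} → P w → Q w) → HasCard P ∞ → HasCard Q ∞
HasCard-∞-mono P⇒Q unbounded N with unbounded N
... | w , N≤w , Pw = w , N≤w , P⇒Q Pw

OutDeg∞⇒Deg∞ : ∀ {v} → OutDeg v ∞ → Deg v ∞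
OutDeg∞⇒Deg∞ = HasCard-∞-mono inj₂

twinPrimes⇒OutDeg[2]∞ : InfinitelyManyTwinPrimes → OutDeg 2 ∞
twinPrimes⇒OutDeg[2]∞ twins N with twins N
... | q , N≤q , pq , pq+2 =
  2 + 2 * q , ≤-trans N≤q (≤-trans (m≤n*m q 2) (m≤n+m (2 * q) 2)) , twin⇒Arc-from-2 pq pq+2

OutDeg[2]∞⇒twinPrimes : OutDeg 2 ∞ → InfinitelyManyTwinPrimes
OutDeg[2]∞⇒twinPrimes unbounded N with unbounded (2 + 2 * N)
... | b , 2+2N≤b , arc with Arc-from-2⇒twin arc
...   | q , refl , pq , pq+2 = q , *-cancelˡ-≤ 2 (+-cancelˡ-≤ 2 _ _ 2+2N≤b) , pq , pq+2

mainTheorem8 : InfinitelyManyTwinPrimes ⇔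
    Σ ℕ∞ (λ d → Deg 2 d × OutDeg 2 d × d ≡ ∞)
mainTheorem8 = mk⇔
  (λ twins → let out = twinPrimes⇒OutDeg[2]∞ twins in ∞ , OutDeg∞⇒Deg∞ out , out , refl)
  (λ { (.∞ , _ , out , refl) → OutDeg[2]∞⇒twinPrimes out })
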